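{- Let $k$, $n$ and $s$ be positive integers and let $x_1,\ldots,x_n$ be independent variables. Then $$H_k^{(s)}(x_1,\ldots,x_n)=\begin{cases}\sum_{P\in\mathcal P_{n,k}^s}X^P, & \text{if } s \text{ is odd},\\[2pt] (-1)^k\sum_{P\in\mathcal P_{n,k}^s}(-1)^{P'}X^P, & \text{otherwise}.\end{cases}$$
   Context: For a positive integer $s$, $H_k^{(s)}$ ($k\ge0$) is defined by $\sum_{k\ge0}H_k^{(s)}(x_1,\ldots,x_n)t^k=\prod_{i=1}^n\big(1-x_it+\cdots+(-x_it)^s\big)^{ -1}$. Consider lattice paths from $(0,0)$ to $(k,n-1)$ using unit east steps $(1,0)$ and unit north steps $(0,1)$. For such a path $P$ and $j=0,1,\ldots,n-1$, let $a_j(P)$ be the number of east steps of $P$ lying on the horizontal line $y=j$ (level $j+1$). $\mathcal P_{n,k}^s$ is the set of such paths with $a_j(P)\equiv0$ or $1\pmod{s+1}$ for every $j$. Each east step $p$ receives the label $L(p)=$ (number of north steps preceding $p$) $+1$, and $X^P=\prod_{p\text{ east step of }P}x_{L(p)}=\prod_{j=0}^{n-1}x_{j+1}^{a_j(P)}$. Let $n_{j+1}(P)$ be the least nonnegative residue of $a_j(P)$ modulo $s+1$, and $P'=\sum_{j}n_{j+1}(P)$. -}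

module Defs where

open import Level using (Level)
open import Algebra.Bundles using (CommutativeRing)
open import Data.Nat as ℕ using (ℕ; zero; suc; _∸_; _%_; _≤ᵇ_)
open import Data.Bool using (Bool; true; false; if_then_else_; _∧_)
open import Data.Fin using (Fin; toℕ)
open import Data.List as List using (List; []; _∷_)
open import Data.Vec as Vec using (Vec; []; _∷_)
open import Data.Nat.ListAction using (sum)

data Step : Set where
  E N : Step   -- E = east step (1,0), N = north step (0,1)

paths : ℕ → ℕ → List (List Step)
paths zero    zero    = [] ∷ []
paths zero    (suc m) = List.map (N ∷_) (paths zero m)
paths (suc e) zero    = List.map (E ∷_) (paths e zero)
paths (suc e) (suc m) =
  List.map (E ∷_) (paths e (suc m)) List.++ List.map (N ∷_) (paths (suc e) m)

-- a j P : number of east steps of P on the horizontal line y = j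
a : List Step → ℕ → ℕ
a []      _       = zero
a (E ∷ p) zero    = suc (a p zero)
a (N ∷ p) zero    = zero
a (E ∷ p) (suc j) = a p (suc j)
a (N ∷ p) (suc j) = a p j

admissible : (s n : ℕ) → List Step → Bool
admissible s n P = List.foldr (λ j b → ((a P j % suc s) ≤ᵇ 1) ∧ b) true (List.upTo n)

𝒫 : (n k s : ℕ) → List (List Step)
𝒫 n k s = List.filterᵇ (admissible s n) (paths k (n ∸ 1))

P′ : (s n : ℕ) → List Step → ℕ
P′ s n P = sum (List.map (λ j → a P j % suc s) (List.upTo n))

module Series {c ℓ : Level} (R : CommutativeRing c ℓ) where
  open CommutativeRing R

  pow : Carrier → ℕ → Carrier
  pow x zero    = 1#
  pow x (suc m) = x * pow x m

  sumV : ∀ {m} → Vec Carrier m → Carrier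
  sumV = Vec.foldr _ _+_ 0#

  sumL : List Carrier → Carrier
  sumL = List.foldr _+_ 0#

  prodL : List Carrier → Carrier
  prodL = List.foldr _*_ 1#

  -- formal power series in t: coefficient sequences
  PS : Set c
  PS = ℕ → Carrier

  one : PS
  one zero    = 1#
  one (suc _) = 0#

  _⊛_ : PS → PS → PS
  (f ⊛ g) m = sumV (Vec.map (λ i → f i * g (m ∸ i)) (Vec.tabulate {n = suc m} toℕ))

  -- inverse of a power series with constant term 1:
  -- g 0 = 1, g m = - Σ_{j=1}^{m} f j * g (m - j).
  -- invUpTo f m = (g m ∷ g (m-1) ∷ … ∷ g 0 ∷ [])
  invUpTo : PS → (m : ℕ) → Vec Carrier (suc m)
  invUpTo f zero    = 1# ∷ []
  invUpTo f (suc m) =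
    (- sumV (Vec.zipWith (λ j g → f (suc j) * g)
                         (Vec.tabulate {n = suc m} toℕ) (invUpTo f m)))
    ∷ invUpTo f m

  inv : PS → PS
  inv f m = Vec.head (invUpTo f m)

  factor : ℕ → Carrier → PS
  factor s y j = if j ℕ.≤ᵇ s then pow (- y) j else 0#

  -- Σ_k H_k^{(s)}(x_1,…,x_n) t^k = ∏_i (1 - x_i t + ⋯ + (-x_i t)^s)^{-1}
  -- (x i plays the role of x_{i+1})
  H : (s k n : ℕ) → (Fin n → Carrier) → Carrier
  H s k n x = inv (List.foldr (λ i f → factor s (x i) ⊛ f) one (List.allFin n)) k

  X : (n : ℕ) → (Fin n → Carrier) → List Step → Carrier
  X n x P = prodL (List.map (λ j → pow (x j) (a P (toℕ j))) (List.allFin n))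

  pathSum : (n k s : ℕ) → (Fin n → Carrier) → Carrier
  pathSum n k s x = sumL (List.map (X n x) (𝒫 n k s))

  signedPathSum : (n k s : ℕ) → (Fin n → Carrier) → Carrier
  signedPathSum n k s x =
    sumL (List.map (λ P → pow (- 1#) (P′ s n P) * X n x P) (𝒫 n k s))

-- Multiplying 1 - y t + ⋯ + (-y t)^s by 1 + y t telescopes it to 1 - (-y t)^(s+1), so
-- its inverse is (1 + y t) / (1 - (-y t)^(s+1)): the coefficient of t^a is σ(a) y^a if
-- a ≡ 0 or 1 (mod s+1) and 0 otherwise, for any σ with σ(0) = σ(1) = 1 and
-- σ(a+s+1) = (-1)^(s+1) σ(a). The coefficient of t^k in a product of n series is a sum
-- over compositions (a₁,…,aₙ) of k, i.e. over lattice paths from (0,0) to (k,n-1), of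
-- ∏ⱼ cⱼ(aⱼ); for the inverted factors exactly the paths of 𝒫 survive. For odd s one
-- may take σ ≡ 1; for every s one may take σ(a) = (-1)^a (-1)^(a mod (s+1)), and since
-- Σⱼ aⱼ = k this yields the signs (-1)^k (-1)^P′.
module Submission where

open import Defs
open import Level using (Level)
open import Algebra.Bundles using (CommutativeRing; CommutativeMonoid)
open import Data.Bool using (Bool; true; false; if_then_else_; _∧_; T)
open import Data.Empty using (⊥-elim)
open import Data.Fin.Base using (Fin; zero; suc; toℕ)
open import Data.List.Base as List using (List; []; _∷_)
import Data.List.Properties as List
open import Data.List.Relation.Unary.All as All using (All; []; _∷_)
import Data.List.Relation.Unary.All.Properties as All
open import Data.Nat.Base as ℕ using (ℕ; zero; suc; _<_; _≤_; _%_; _∸_; _≤ᵇ_; z≤n; s≤s)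
import Data.Nat.Properties as ℕ
open import Data.Nat.DivMod using ([m+n]%n≡m%n; m<n⇒m%n≡m)
open import Data.Product using (_×_; _,_)
import Data.Vec.Base as Vec
import Data.Vec.Functional as Vector
open import Function.Base using (_∘_; id)
open import Function.Indexed.Relation.Binary.Equality using (≡-setoid)
open import Relation.Binary.Bundles using (Setoid)
open import Relation.Binary.Definitions using (tri<; tri≈; tri>)
import Relation.Binary.Indexed.Heterogeneous.Construct.Trivial as Trivial
open import Relation.Binary.PropositionalEquality as ≡ using (_≡_; _≢_)
import Relation.Binary.Reasoning.Setoid as SetoidReasoning
open import Relation.Nullary using (¬_; yes; no)

open import Algebra.Definitions.RawMonoid ℕ.+-0-rawMonoid using () renaming (sum to ∑ℕ)

private
  variable
    ℓ₁ ℓ₂ ℓ₃ : Level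
    A : Set ℓ₁
    B : Set ℓ₂
    C : Set ℓ₃

if-T : ∀ {b} {x y : A} → T b → (if b then x else y) ≡ x
if-T {b = true} _ = ≡.refl

if-¬T : ∀ {b} {x y : A} → ¬ T b → (if b then x else y) ≡ y
if-¬T {b = false} _  = ≡.refl
if-¬T {b = true}  ¬t = ⊥-elim (¬t _)

foldr-tabulate : ∀ {n} (f : B → C → C) e (g : A → B) (h : Fin n → A) →
  List.foldr (λ i → f (g i)) e (List.tabulate h) ≡ Vector.foldr f e (g ∘ h)
foldr-tabulate {n = zero}  f e g h = ≡.refl
foldr-tabulate {n = suc n} f e g h = ≡.cong (f (g (h zero))) (foldr-tabulate f e g (h ∘ suc))

foldr-applyUpTo : ∀ (f : B → C → C) e (g : A → B) (h : ℕ → A) n →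
  List.foldr (λ i → f (g i)) e (List.applyUpTo h n) ≡ Vector.foldr f e {n} (g ∘ h ∘ toℕ)
foldr-applyUpTo f e g h zero    = ≡.refl
foldr-applyUpTo f e g h (suc n) = ≡.cong (f (g (h 0))) (foldr-applyUpTo f e g (h ∘ suc) n)

eastTotal : ∀ n → List Step → ℕ
eastTotal n Q = ∑ℕ (λ (j : Fin n) → a Q (toℕ j))

paths-eastTotal : ∀ k m → All (λ Q → eastTotal (suc m) Q ≡ k) (paths k m)
paths-eastTotal zero    zero    = ≡.refl ∷ []
paths-eastTotal (suc k) zero    = All.map⁺ (All.map (≡.cong suc) (paths-eastTotal k zero))
paths-eastTotal zero    (suc m) = All.map⁺ (paths-eastTotal zero m)
paths-eastTotal (suc k) (suc m) = All.++⁺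
  (All.map⁺ (All.map (≡.cong suc) (paths-eastTotal k (suc m))))
  (All.map⁺ (paths-eastTotal (suc k) m))

𝒫-eastTotal : ∀ n k s → All (λ Q → eastTotal (suc n) Q ≡ k) (𝒫 (suc n) k s)
𝒫-eastTotal n k s = All.filter⁺ _ (paths-eastTotal k n)

admissible≡all : ∀ s n Q →
  admissible s n Q ≡ Vector.foldr _∧_ true (λ (j : Fin n) → a Q (toℕ j) % suc s ≤ᵇ 1)
admissible≡all s n Q = foldr-applyUpTo _∧_ true (λ j → a Q j % suc s ≤ᵇ 1) id n

P′≡∑ℕ : ∀ s n Q → P′ s n Q ≡ ∑ℕ (λ (j : Fin n) → a Q (toℕ j) % suc s)
P′≡∑ℕ s n Q = ≡.trans (List.foldr-map ℕ._+_ (λ j → a Q j % suc s) 0 (List.upTo n))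
                      (foldr-applyUpTo ℕ._+_ 0 (λ j → a Q j % suc s) id n)

module _ {c ℓ : Level} (R : CommutativeRing c ℓ) where
  open CommutativeRing R hiding (zero)
  open Series R
  open import Algebra.Properties.Ring ring using (-‿distribˡ-*; -1*x≈-x)
  open import Algebra.Properties.Group +-group using (⁻¹-involutive)
  open import Algebra.Properties.CommutativeMonoid.Sum +-commutativeMonoid
    using () renaming (sum to ∑)
  open import Algebra.Properties.CommutativeMonoid.Sum *-commutativeMonoid
    using () renaming (sum to ∏; sum-cong-≋ to ∏-cong; ∑-distrib-+ to ∏-distrib-*)
  open import Algebra.Solver.Ring.NaturalCoefficients.Default commutativeSemiring
    using (solve; _:=_; _:+_; _:*_)
  module ≈-Reasoning = SetoidReasoning setoid

  -- Formal power series

  ≐-setoid : Setoid c ℓ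
  ≐-setoid = ≡-setoid ℕ (Trivial.indexedSetoid setoid)

  open Setoid ≐-setoid using ()
    renaming (_≈_ to _≐_; refl to ≐-refl; sym to ≐-sym; trans to ≐-trans)
  module ≐-Reasoning = SetoidReasoning ≐-setoid

  -- The Cauchy product _⊛_ (see ⊛≐·), written recursively in the first factor.
  infixl 7 _·_
  _·_ : PS → PS → PS
  (f · g) zero    = f 0 * g 0
  (f · g) (suc m) = f 0 * g (suc m) + ((f ∘ suc) · g) m

  ·-cong : ∀ {f f′ g g′} → f ≐ f′ → g ≐ g′ → f · g ≐ f′ · g′
  ·-cong f≐f′ g≐g′ zero    = *-cong (f≐f′ 0) (g≐g′ 0)
  ·-cong f≐f′ g≐g′ (suc m) =
    +-cong (*-cong (f≐f′ 0) (g≐g′ (suc m))) (·-cong (f≐f′ ∘ suc) g≐g′ m)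

  ·-zeroˡ : ∀ g → (λ _ → 0#) · g ≐ (λ _ → 0#)
  ·-zeroˡ g zero    = zeroˡ _
  ·-zeroˡ g (suc m) = trans (+-cong (zeroˡ _) (·-zeroˡ g m)) (+-identityʳ 0#)

  ·-identityˡ : ∀ g → one · g ≐ g
  ·-identityˡ g zero    = *-identityˡ _
  ·-identityˡ g (suc m) = trans (+-cong (*-identityˡ _) (·-zeroˡ g m)) (+-identityʳ _)

  ·-unfoldʳ : ∀ f g m → (f · g) (suc m) ≈ (f · (g ∘ suc)) m + f (suc m) * g 0
  ·-unfoldʳ f g zero    = refl
  ·-unfoldʳ f g (suc m) = trans (+-congˡ (·-unfoldʳ (f ∘ suc) g m)) (sym (+-assoc _ _ _))

  ·-comm : ∀ f g → f · g ≐ g · f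
  ·-comm f g zero    = *-comm _ _
  ·-comm f g (suc m) = begin
    f 0 * g (suc m) + ((f ∘ suc) · g) m   ≈⟨ +-cong (*-comm _ _) (·-comm (f ∘ suc) g m) ⟩
    g (suc m) * f 0 + (g · (f ∘ suc)) m   ≈⟨ +-comm _ _ ⟩
    (g · (f ∘ suc)) m + g (suc m) * f 0   ≈⟨ ·-unfoldʳ g f m ⟨
    (g · f) (suc m)                       ∎
    where open ≈-Reasoning

  ·-identityʳ : ∀ f → f · one ≐ f
  ·-identityʳ f = ≐-trans (·-comm f one) (·-identityˡ f)

  ·-distribʳ-+ : ∀ f f′ g → (λ i → f i + f′ i) · g ≐ (λ i → (f · g) i + (f′ · g) i)
  ·-distribʳ-+ f f′ g zero    = distribʳ _ _ _
  ·-distribʳ-+ f f′ g (suc m) = begin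
    (f 0 + f′ 0) * g (suc m) + ((λ i → f (suc i) + f′ (suc i)) · g) m
      ≈⟨ +-cong (distribʳ _ _ _) (·-distribʳ-+ (f ∘ suc) (f′ ∘ suc) g m) ⟩
    (f 0 * g (suc m) + f′ 0 * g (suc m)) + (((f ∘ suc) · g) m + ((f′ ∘ suc) · g) m)
      ≈⟨ solve 4 (λ p q r t → (p :+ q) :+ (r :+ t) := (p :+ r) :+ (q :+ t)) refl _ _ _ _ ⟩
    (f · g) (suc m) + (f′ · g) (suc m) ∎
    where open ≈-Reasoning

  ·-scaleˡ : ∀ u f g → (λ i → u * f i) · g ≐ (λ i → u * (f · g) i)
  ·-scaleˡ u f g zero    = *-assoc _ _ _
  ·-scaleˡ u f g (suc m) =
    trans (+-cong (*-assoc _ _ _) (·-scaleˡ u (f ∘ suc) g m)) (sym (distribˡ _ _ _))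

  ·-assoc : ∀ f g h → (f · g) · h ≐ f · (g · h)
  ·-assoc f g h zero    = *-assoc _ _ _
  ·-assoc f g h (suc m) = begin
    (f 0 * g 0) * h (suc m) + ((λ i → f 0 * g (suc i) + ((f ∘ suc) · g) i) · h) m
      ≈⟨ +-congˡ (·-distribʳ-+ (λ i → f 0 * g (suc i)) ((f ∘ suc) · g) h m) ⟩
    (f 0 * g 0) * h (suc m) + (((λ i → f 0 * g (suc i)) · h) m + (((f ∘ suc) · g) · h) m)
      ≈⟨ +-congˡ (+-cong (·-scaleˡ (f 0) (g ∘ suc) h m) (·-assoc (f ∘ suc) g h m)) ⟩
    (f 0 * g 0) * h (suc m) + (f 0 * ((g ∘ suc) · h) m + ((f ∘ suc) · (g · h)) m)
      ≈⟨ solve 5 (λ p q r t u → (p :* q) :* r :+ (p :* t :+ u) := p :* (q :* r :+ t) :+ u) refl _ _ _ _ _ ⟩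
    (f · (g · h)) (suc m) ∎
    where open ≈-Reasoning

  ·-commutativeMonoid : CommutativeMonoid c ℓ
  ·-commutativeMonoid = record
    { Carrier = PS
    ; _≈_     = _≐_
    ; _∙_     = _·_
    ; ε       = one
    ; isCommutativeMonoid = record
      { isMonoid = record
        { isSemigroup = record
          { isMagma = record
            { isEquivalence = Setoid.isEquivalence ≐-setoid
            ; ∙-cong        = ·-cong
            }
          ; assoc = ·-assoc
          }
        ; identity = ·-identityˡ , ·-identityʳ
        }
      ; comm = ·-comm
      }
    }

  open import Algebra.Properties.CommutativeMonoid.Sum ·-commutativeMonoid using ()
    renaming ( sum to ∏ˢ; sum-cong-≋ to ∏ˢ-cong; ∑-distrib-+ to ∏ˢ-distrib-·
             ; sum-replicate-zero to ∏ˢ-one)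

  ∏ˢ-inverse : ∀ {n} (f g : Fin n → PS) → (∀ j → f j · g j ≐ one) → ∏ˢ f · ∏ˢ g ≐ one
  ∏ˢ-inverse {n} f g fg≐one = begin
    ∏ˢ f · ∏ˢ g                ≈⟨ ∏ˢ-distrib-· f g ⟨
    ∏ˢ (λ j → f j · g j)       ≈⟨ ∏ˢ-cong fg≐one ⟩
    ∏ˢ {n} (λ _ → one)         ≈⟨ ∏ˢ-one n ⟩
    one                        ∎
    where open ≐-Reasoning

  ∏ˢ-constantTerm : ∀ {n} (f : Fin n → PS) → (∀ j → f j 0 ≈ 1#) → ∏ˢ f 0 ≈ 1#
  ∏ˢ-constantTerm {zero}  f f0≈1 = refl
  ∏ˢ-constantTerm {suc n} f f0≈1 =
    trans (*-cong (f0≈1 zero) (∏ˢ-constantTerm (f ∘ suc) (f0≈1 ∘ suc))) (*-identityˡ 1#)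

  -- Inverses

  sumV-map-tabulate : ∀ {n} (φ : ℕ → Carrier) (g : Fin n → ℕ) →
    sumV (Vec.map φ (Vec.tabulate g)) ≡ ∑ (φ ∘ g)
  sumV-map-tabulate {zero}  φ g = ≡.refl
  sumV-map-tabulate {suc n} φ g = ≡.cong (φ (g zero) +_) (sumV-map-tabulate φ (g ∘ suc))

  sumV-zipWith-tabulate : ∀ {n} (F : ℕ → Carrier → Carrier) (g : Fin n → ℕ) (h : Fin n → Carrier) →
    sumV (Vec.zipWith F (Vec.tabulate g) (Vec.tabulate h)) ≡ ∑ (λ i → F (g i) (h i))
  sumV-zipWith-tabulate {zero}  F g h = ≡.refl
  sumV-zipWith-tabulate {suc n} F g h =
    ≡.cong (F (g zero) (h zero) +_) (sumV-zipWith-tabulate F (g ∘ suc) (h ∘ suc))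

  ∑-convolution : ∀ f g m → ∑ {suc m} (λ i → f (toℕ i) * g (m ∸ toℕ i)) ≈ (f · g) m
  ∑-convolution f g zero    = +-identityʳ _
  ∑-convolution f g (suc m) = +-congˡ (∑-convolution (f ∘ suc) g m)

  ⊛≐· : ∀ f g → f ⊛ g ≐ f · g
  ⊛≐· f g m = trans (reflexive (sumV-map-tabulate (λ i → f i * g (m ∸ i)) (toℕ {suc m})))
                    (∑-convolution f g m)

  invUpTo≡tabulate : ∀ f m → invUpTo f m ≡ Vec.tabulate (λ i → inv f (m ∸ toℕ i))
  invUpTo≡tabulate f zero    = ≡.refl
  invUpTo≡tabulate f (suc m) = ≡.cong (inv f (suc m) Vec.∷_) (invUpTo≡tabulate f m)

  inv-suc : ∀ f m → inv f (suc m) ≈ - ((f ∘ suc) · inv f) m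
  inv-suc f m = -‿cong (begin
    sumV (Vec.zipWith F (Vec.tabulate (toℕ {suc m})) (invUpTo f m))
      ≡⟨ ≡.cong (sumV ∘ Vec.zipWith F (Vec.tabulate toℕ)) (invUpTo≡tabulate f m) ⟩
    sumV (Vec.zipWith F (Vec.tabulate toℕ) (Vec.tabulate {n = suc m} (λ i → inv f (m ∸ toℕ i))))
      ≡⟨ sumV-zipWith-tabulate F (toℕ {suc m}) (λ i → inv f (m ∸ toℕ i)) ⟩
    ∑ {suc m} (λ i → f (suc (toℕ i)) * inv f (m ∸ toℕ i))
      ≈⟨ ∑-convolution (f ∘ suc) (inv f) m ⟩
    ((f ∘ suc) · inv f) m ∎)
    where
    open ≈-Reasoning
    F : ℕ → Carrier → Carrier
    F j v = f (suc j) * v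

  ·-inverseʳ : ∀ f → f 0 ≈ 1# → f · inv f ≐ one
  ·-inverseʳ f f0≈1 zero    = trans (*-identityʳ _) f0≈1
  ·-inverseʳ f f0≈1 (suc m) = begin
    f 0 * inv f (suc m) + ((f ∘ suc) · inv f) m       ≈⟨ +-congʳ (*-cong f0≈1 (inv-suc f m)) ⟩
    1# * - ((f ∘ suc) · inv f) m + ((f ∘ suc) · inv f) m ≈⟨ +-congʳ (*-identityˡ _) ⟩
    - ((f ∘ suc) · inv f) m + ((f ∘ suc) · inv f) m  ≈⟨ -‿inverseˡ _ ⟩
    0#                                               ∎
    where open ≈-Reasoning

  ·-cancelˡ : ∀ {b g h} → b 0 ≈ 1# → b · g ≐ b · h → g ≐ h
  ·-cancelˡ {b} {g} {h} b0≈1 bg≐bh = begin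
    g                 ≈⟨ ·-identityˡ g ⟨
    one · g           ≈⟨ ·-cong b⁻¹b≐one ≐-refl ⟨
    (inv b · b) · g   ≈⟨ ·-assoc _ _ _ ⟩
    inv b · (b · g)   ≈⟨ ·-cong ≐-refl bg≐bh ⟩
    inv b · (b · h)   ≈⟨ ·-assoc _ _ _ ⟨
    (inv b · b) · h   ≈⟨ ·-cong b⁻¹b≐one ≐-refl ⟩
    one · h           ≈⟨ ·-identityˡ h ⟩
    h                 ∎
    where
    open ≐-Reasoning
    b⁻¹b≐one : inv b · b ≐ one
    b⁻¹b≐one = ≐-trans (·-comm (inv b) b) (·-inverseʳ b b0≈1)

  inverse-unique : ∀ {f g} → f 0 ≈ 1# → f · g ≐ one → g ≐ inv f
  inverse-unique {f} f0≈1 fg≐one =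
    ·-cancelˡ f0≈1 (≐-trans fg≐one (≐-sym (·-inverseʳ f f0≈1)))

  ⊛-product≐∏ˢ : ∀ {n} (f : Fin n → PS) → Vector.foldr _⊛_ one f ≐ ∏ˢ f
  ⊛-product≐∏ˢ {zero}  f = ≐-refl
  ⊛-product≐∏ˢ {suc n} f = ≐-trans (⊛≐· _ _) (·-cong ≐-refl (⊛-product≐∏ˢ (f ∘ suc)))

  H≈∏ˢ : ∀ s k n (x : Fin n → Carrier) (g : Fin n → PS) →
    (∀ j → factor s (x j) · g j ≐ one) → H s k n x ≈ ∏ˢ g k
  H≈∏ˢ s k n x g inverses = sym (inverse-unique P0≈1 P·∏g≐one k)
    where
    P : PS
    P = List.foldr (λ i f → factor s (x i) ⊛ f) one (List.allFin n)
    P≐∏ˢ : P ≐ ∏ˢ (factor s ∘ x)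
    P≐∏ˢ i = trans (reflexive (≡.cong-app (foldr-tabulate _⊛_ one (factor s ∘ x) id) i))
                   (⊛-product≐∏ˢ (factor s ∘ x) i)
    P0≈1 : P 0 ≈ 1#
    P0≈1 = trans (P≐∏ˢ 0) (∏ˢ-constantTerm (factor s ∘ x) (λ _ → refl))
    P·∏g≐one : P · ∏ˢ g ≐ one
    P·∏g≐one = ≐-trans (·-cong P≐∏ˢ ≐-refl) (∏ˢ-inverse (factor s ∘ x) g inverses)

  pow-+ : ∀ v m n → pow v (m ℕ.+ n) ≈ pow v m * pow v n
  pow-+ v zero    n = sym (*-identityˡ _)
  pow-+ v (suc m) n = trans (*-congˡ (pow-+ v m n)) (sym (*-assoc _ _ _))

  pow-neg : ∀ v n → pow (- v) n ≈ pow (- 1#) n * pow v n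
  pow-neg v zero    = sym (*-identityˡ _)
  pow-neg v (suc n) = begin
    - v * pow (- v) n                      ≈⟨ *-cong (-1*x≈-x v) (sym (pow-neg v n)) ⟨
    (- 1# * v) * (pow (- 1#) n * pow v n)
      ≈⟨ solve 4 (λ u w p q → (u :* w) :* (p :* q) := (u :* p) :* (w :* q)) refl _ _ _ _ ⟩
    (- 1# * pow (- 1#) n) * (v * pow v n)  ∎
    where open ≈-Reasoning

  -1*[-1*x]≈x : ∀ v → - 1# * (- 1# * v) ≈ v
  -1*[-1*x]≈x v = trans (-1*x≈-x _) (trans (-‿cong (-1*x≈-x v)) (⁻¹-involutive v))

  pow[-1]-odd : ∀ n → n % 2 ≡ 1 → pow (- 1#) n ≈ - 1#
  pow[-1]-odd n odd = trans (trans (parity n) (reflexive (≡.cong (pow (- 1#)) odd))) (*-identityʳ _)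
    where
    parity : ∀ n → pow (- 1#) n ≈ pow (- 1#) (n % 2)
    parity 0             = refl
    parity 1             = refl
    parity (suc (suc n)) = trans (-1*[-1*x]≈x _) (trans (parity n) (reflexive (≡.cong (pow (- 1#)) n%2≡[2+n]%2)))
      where
      n%2≡[2+n]%2 : n % 2 ≡ suc (suc n) % 2
      n%2≡[2+n]%2 = ≡.trans (≡.sym ([m+n]%n≡m%n n 2)) (≡.cong (_% 2) (ℕ.+-comm n 2))

  pow-∑ℕ : ∀ v {n} (q : Fin n → ℕ) → pow v (∑ℕ q) ≈ ∏ (λ j → pow v (q j))
  pow-∑ℕ v {zero}  q = refl
  pow-∑ℕ v {suc n} q = trans (pow-+ v (q zero) _) (*-congˡ (pow-∑ℕ v (q ∘ suc)))

  if-congᵇ : ∀ b {x y} → x ≈ y → (if b then x else 0#) ≈ (if b then y else 0#)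
  if-congᵇ true  x≈y = x≈y
  if-congᵇ false x≈y = refl

  *-ifᵇ : ∀ b u x → u * (if b then x else 0#) ≈ (if b then u * x else 0#)
  *-ifᵇ true  u x = refl
  *-ifᵇ false u x = zeroʳ u

  ∏-ifᵇ : ∀ {n} (b : Fin n → Bool) (u : Fin n → Carrier) →
    ∏ (λ j → if b j then u j else 0#) ≈ (if Vector.foldr _∧_ true b then ∏ u else 0#)
  ∏-ifᵇ {zero}  b u = refl
  ∏-ifᵇ {suc n} b u with b zero
  ... | true  = trans (*-congˡ (∏-ifᵇ (b ∘ suc) (u ∘ suc))) (*-ifᵇ (Vector.foldr _∧_ true (b ∘ suc)) _ _)
  ... | false = zeroˡ _

  X≡∏ : ∀ n (x : Fin n → Carrier) Q → X n x Q ≡ ∏ (λ j → pow (x j) (a Q (toℕ j)))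
  X≡∏ n x Q = ≡.trans (List.foldr-map _*_ (λ j → pow (x j) (a Q (toℕ j))) 1# (List.allFin n))
                      (foldr-tabulate _*_ 1# (λ j → pow (x j) (a Q (toℕ j))) id)

  -- Inverse of a single factor

  monomial : ℕ → Carrier → PS
  monomial zero    v zero    = v
  monomial zero    v (suc _) = 0#
  monomial (suc r) v zero    = 0#
  monomial (suc r) v (suc j) = monomial r v j

  binomial : ℕ → Carrier → PS
  binomial r v zero    = 1#
  binomial r v (suc j) = monomial r v j

  monomial-diagonal : ∀ r v → monomial r v r ≡ v
  monomial-diagonal zero    v = ≡.refl
  monomial-diagonal (suc r) v = monomial-diagonal r v

  monomial-offDiagonal : ∀ r v {m} → m ≢ r → monomial r v m ≡ 0#
  monomial-offDiagonal zero    v {zero}  m≢r = ⊥-elim (m≢r ≡.refl)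
  monomial-offDiagonal zero    v {suc m} m≢r = ≡.refl
  monomial-offDiagonal (suc r) v {zero}  m≢r = ≡.refl
  monomial-offDiagonal (suc r) v {suc m} m≢r = monomial-offDiagonal r v (m≢r ∘ ≡.cong suc)

  monomial-·-< : ∀ r v g {m} → m < r → (monomial r v · g) m ≈ 0#
  monomial-·-< (suc r) v g {zero}  _         = zeroˡ _
  monomial-·-< (suc r) v g {suc m} (s≤s m<r) =
    trans (+-cong (zeroˡ _) (monomial-·-< r v g m<r)) (+-identityʳ 0#)

  monomial-·-≥ : ∀ r v g {m} → r ≤ m → (monomial r v · g) m ≈ v * g (m ∸ r)
  monomial-·-≥ zero    v g {zero}  _         = refl
  monomial-·-≥ zero    v g {suc m} _         = trans (+-congˡ (·-zeroˡ g m)) (+-identityʳ _)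
  monomial-·-≥ (suc r) v g {suc m} (s≤s r≤m) =
    trans (+-cong (zeroˡ _) (monomial-·-≥ r v g r≤m)) (+-identityˡ _)

  binomial-·-suc : ∀ r v g m → (binomial r v · g) (suc m) ≈ g (suc m) + (monomial r v · g) m
  binomial-·-suc r v g m = +-congʳ (*-identityˡ _)

  factor-≤ : ∀ s y {j} → j ≤ s → factor s y j ≡ pow (- y) j
  factor-≤ s y j≤s = if-T (ℕ.≤⇒≤ᵇ j≤s)

  factor-> : ∀ s y {j} → s < j → factor s y j ≡ 0#
  factor-> s y {j} s<j = if-¬T (ℕ.<⇒≱ s<j ∘ ℕ.≤ᵇ⇒≤ j s)

  factor-telescope : ∀ s y m →
    factor s y (suc m) + y * factor s y m ≈ monomial s (y * pow (- y) s) m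
  factor-telescope s y m with ℕ.<-cmp m s
  ... | tri< m<s _ _ = begin
    factor s y (suc m) + y * factor s y m
      ≡⟨ ≡.cong₂ (λ u v → u + y * v) (factor-≤ s y m<s) (factor-≤ s y (ℕ.<⇒≤ m<s)) ⟩
    - y * pow (- y) m + y * pow (- y) m   ≈⟨ +-congʳ (-‿distribˡ-* y _) ⟨
    - (y * pow (- y) m) + y * pow (- y) m ≈⟨ -‿inverseˡ _ ⟩
    0#                                    ≡⟨ monomial-offDiagonal s _ (ℕ.<⇒≢ m<s) ⟨
    monomial s (y * pow (- y) s) m        ∎
    where open ≈-Reasoning
  ... | tri≈ _ ≡.refl _ = begin
    factor s y (suc s) + y * factor s y s
      ≡⟨ ≡.cong₂ (λ u v → u + y * v) (factor-> s y ℕ.≤-refl) (factor-≤ s y ℕ.≤-refl) ⟩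
    0# + y * pow (- y) s                  ≈⟨ +-identityˡ _ ⟩
    y * pow (- y) s                       ≡⟨ monomial-diagonal s _ ⟨
    monomial s (y * pow (- y) s) s        ∎
    where open ≈-Reasoning
  ... | tri> _ _ s<m = begin
    factor s y (suc m) + y * factor s y m
      ≡⟨ ≡.cong₂ (λ u v → u + y * v) (factor-> s y (ℕ.m<n⇒m<1+n s<m)) (factor-> s y s<m) ⟩
    0# + y * 0#                           ≈⟨ trans (+-identityˡ _) (zeroʳ y) ⟩
    0#                                    ≡⟨ monomial-offDiagonal s _ (ℕ.>⇒≢ s<m) ⟨
    monomial s (y * pow (- y) s) m        ∎
    where open ≈-Reasoning

  binomial-·-factor : ∀ s y → binomial 0 y · factor s y ≐ binomial s (y * pow (- y) s)
  binomial-·-factor s y zero    = *-identityˡ _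
  binomial-·-factor s y (suc m) = begin
    (binomial 0 y · factor s y) (suc m)               ≈⟨ binomial-·-suc 0 y (factor s y) m ⟩
    factor s y (suc m) + (monomial 0 y · factor s y) m ≈⟨ +-congˡ (monomial-·-≥ 0 y (factor s y) {m} z≤n) ⟩
    factor s y (suc m) + y * factor s y m             ≈⟨ factor-telescope s y m ⟩
    monomial s (y * pow (- y) s) m                    ∎
    where open ≈-Reasoning

  factorInverse : ℕ → (ℕ → Carrier) → Carrier → PS
  factorInverse s σ y i = if i % suc s ≤ᵇ 1 then σ i * pow y i else 0#

  module _ {s : ℕ} (s>0 : 0 < s) {σ : ℕ → Carrier} (σ-0 : σ 0 ≈ 1#) (σ-1 : σ 1 ≈ 1#)
           (σ-+period : ∀ i → σ (i ℕ.+ suc s) ≈ - pow (- 1#) s * σ i) (y : Carrier) where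

    private
      w : Carrier
      w = y * pow (- y) s
      fi : PS
      fi = factorInverse s σ y

    factorInverse-0 : factorInverse s σ y 0 ≈ 1#
    factorInverse-0 = trans (*-identityʳ _) σ-0

    factorInverse-1 : factorInverse s σ y 1 ≈ y
    factorInverse-1 = begin
      factorInverse s σ y 1
        ≡⟨ ≡.cong (λ r → if r ≤ᵇ 1 then σ 1 * pow y 1 else 0#) (m<n⇒m%n≡m (s≤s s>0)) ⟩
      σ 1 * (y * 1#)        ≈⟨ *-cong σ-1 (*-identityʳ y) ⟩
      1# * y                ≈⟨ *-identityˡ y ⟩
      y                     ∎
      where open ≈-Reasoning

    factorInverse-gap : ∀ m → suc (suc m) ≤ s → factorInverse s σ y (suc (suc m)) ≡ 0#
    factorInverse-gap m 2+m≤s = ≡.cong (λ r → if r ≤ᵇ 1 then σ (suc (suc m)) * pow y (suc (suc m)) else 0#)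
                                        (m<n⇒m%n≡m (s≤s 2+m≤s))

    factorInverse-+period : ∀ i → factorInverse s σ y (i ℕ.+ suc s) ≈ - w * factorInverse s σ y i
    factorInverse-+period i = begin
      factorInverse s σ y (i ℕ.+ suc s)
        ≡⟨ ≡.cong (λ r → if r ≤ᵇ 1 then σ (i ℕ.+ suc s) * pow y (i ℕ.+ suc s) else 0#)
                  ([m+n]%n≡m%n i (suc s)) ⟩
      (if i % suc s ≤ᵇ 1 then σ (i ℕ.+ suc s) * pow y (i ℕ.+ suc s) else 0#)
        ≈⟨ if-congᵇ (i % suc s ≤ᵇ 1) shift ⟩
      (if i % suc s ≤ᵇ 1 then - w * (σ i * pow y i) else 0#)
        ≈⟨ *-ifᵇ (i % suc s ≤ᵇ 1) _ _ ⟨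
      - w * factorInverse s σ y i ∎
      where
      open ≈-Reasoning
      shift : σ (i ℕ.+ suc s) * pow y (i ℕ.+ suc s) ≈ - w * (σ i * pow y i)
      shift = begin
        σ (i ℕ.+ suc s) * pow y (i ℕ.+ suc s)
          ≈⟨ *-cong (σ-+period i) (pow-+ y i (suc s)) ⟩
        (- pow (- 1#) s * σ i) * (pow y i * (y * pow y s))
          ≈⟨ *-congʳ (-‿distribˡ-* _ _) ⟨
        - (pow (- 1#) s * σ i) * (pow y i * (y * pow y s))
          ≈⟨ -‿distribˡ-* _ _ ⟨
        - ((pow (- 1#) s * σ i) * (pow y i * (y * pow y s)))
          ≈⟨ -‿cong (solve 5 (λ e t p u q → (e :* t) :* (p :* (u :* q)) := (u :* (e :* q)) :* (t :* p))
                           refl _ _ _ _ _) ⟩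
        - ((y * (pow (- 1#) s * pow y s)) * (σ i * pow y i))
          ≈⟨ -‿distribˡ-* _ _ ⟩
        - (y * (pow (- 1#) s * pow y s)) * (σ i * pow y i)
          ≈⟨ *-congʳ (-‿cong (*-congˡ (pow-neg y s))) ⟨
        - w * (σ i * pow y i) ∎

    binomial-·-factorInverse : binomial s w · factorInverse s σ y ≐ binomial 0 y
    binomial-·-factorInverse zero          = trans (*-identityˡ _) factorInverse-0
    binomial-·-factorInverse (suc zero)    = begin
      (binomial s w · fi) 1        ≈⟨ binomial-·-suc s w fi 0 ⟩
      fi 1 + (monomial s w · fi) 0 ≈⟨ +-cong factorInverse-1 (monomial-·-< s w fi s>0) ⟩
      y + 0#                       ≈⟨ +-identityʳ y ⟩
      y                            ∎
      where open ≈-Reasoning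
    binomial-·-factorInverse (suc (suc m)) with s ℕ.≤? suc m
    ... | yes s≤1+m = begin
      (binomial s w · fi) (2+m)               ≈⟨ binomial-·-suc s w fi (suc m) ⟩
      fi (2+m) + (monomial s w · fi) (suc m)  ≈⟨ +-congˡ (monomial-·-≥ s w fi s≤1+m) ⟩
      fi (2+m) + w * fi r                     ≡⟨ ≡.cong (λ j → fi j + w * fi r) r+period≡2+m ⟨
      fi (r ℕ.+ suc s) + w * fi r             ≈⟨ +-congʳ (factorInverse-+period r) ⟩
      - w * fi r + w * fi r                   ≈⟨ +-congʳ (-‿distribˡ-* w _) ⟨
      - (w * fi r) + w * fi r                 ≈⟨ -‿inverseˡ _ ⟩
      0#                                      ∎
      where
      open ≈-Reasoning
      2+m r : ℕ
      2+m = suc (suc m)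
      r = suc m ∸ s
      r+period≡2+m : r ℕ.+ suc s ≡ 2+m
      r+period≡2+m = ≡.trans (ℕ.+-suc r s) (≡.cong suc (ℕ.m∸n+n≡m s≤1+m))
    ... | no s≰1+m = begin
      (binomial s w · fi) (suc (suc m))              ≈⟨ binomial-·-suc s w fi (suc m) ⟩
      fi (suc (suc m)) + (monomial s w · fi) (suc m) ≈⟨ +-congˡ (monomial-·-< s w fi (ℕ.≰⇒> s≰1+m)) ⟩
      fi (suc (suc m)) + 0#                          ≈⟨ +-identityʳ _ ⟩
      fi (suc (suc m))                               ≡⟨ factorInverse-gap m (ℕ.≰⇒> s≰1+m) ⟩
      0#                                             ∎
      where open ≈-Reasoning

    factor-·-factorInverse : factor s y · factorInverse s σ y ≐ one
    factor-·-factorInverse = ·-cancelˡ {binomial 0 y} refl (begin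
      binomial 0 y · (factor s y · factorInverse s σ y) ≈⟨ ·-assoc _ _ _ ⟨
      (binomial 0 y · factor s y) · factorInverse s σ y ≈⟨ ·-cong (binomial-·-factor s y) ≐-refl ⟩
      binomial s w · factorInverse s σ y                ≈⟨ binomial-·-factorInverse ⟩
      binomial 0 y                                      ≈⟨ ·-identityʳ _ ⟨
      binomial 0 y · one                                ∎)
      where open ≐-Reasoning

  -- Coefficients of a product of series as a sum over lattice paths

  sumL-++ : ∀ (g : A → Carrier) xs ys →
    sumL (List.map g (xs List.++ ys)) ≈ sumL (List.map g xs) + sumL (List.map g ys)
  sumL-++ g []       ys = sym (+-identityˡ _)
  sumL-++ g (x ∷ xs) ys = trans (+-congˡ (sumL-++ g xs ys)) (sym (+-assoc _ _ _))

  sumL-cong : ∀ {g h : A → Carrier} {xs} → All (λ x → g x ≈ h x) xs →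
    sumL (List.map g xs) ≈ sumL (List.map h xs)
  sumL-cong []           = refl
  sumL-cong (gx≈hx ∷ gs) = +-cong gx≈hx (sumL-cong gs)

  sumL-*ˡ : ∀ u (g : A → Carrier) xs → sumL (List.map (λ x → u * g x) xs) ≈ u * sumL (List.map g xs)
  sumL-*ˡ u g []       = sym (zeroʳ u)
  sumL-*ˡ u g (x ∷ xs) = trans (+-congˡ (sumL-*ˡ u g xs)) (sym (distribˡ _ _ _))

  sumL-filterᵇ : ∀ (g : A → Carrier) (p : A → Bool) xs →
    sumL (List.map g (List.filterᵇ p xs)) ≈ sumL (List.map (λ x → if p x then g x else 0#) xs)
  sumL-filterᵇ g p []       = refl
  sumL-filterᵇ g p (x ∷ xs) with p x
  ... | true  = +-congˡ (sumL-filterᵇ g p xs)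
  ... | false = trans (sumL-filterᵇ g p xs) (sym (+-identityˡ _))

  pathWeight : ∀ {n} → (Fin n → PS) → List Step → Carrier
  pathWeight c Q = ∏ (λ j → c j (a Q (toℕ j)))

  shiftFirst : ∀ {n} → (Fin (suc n) → PS) → Fin (suc n) → PS
  shiftFirst c zero    = c zero ∘ suc
  shiftFirst c (suc j) = c (suc j)

  ∑-pathWeight-east : ∀ {n} (c : Fin (suc n) → PS) Qs →
    sumL (List.map (pathWeight c) (List.map (E ∷_) Qs)) ≡ sumL (List.map (pathWeight (shiftFirst c)) Qs)
  ∑-pathWeight-east c Qs = ≡.cong sumL (≡.sym (List.map-∘ Qs))

  ∑-pathWeight-north : ∀ {n} (c : Fin (suc (suc n)) → PS) Qs →
    sumL (List.map (pathWeight c) (List.map (N ∷_) Qs)) ≈ c zero 0 * sumL (List.map (pathWeight (c ∘ suc)) Qs)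
  ∑-pathWeight-north c Qs =
    trans (reflexive (≡.cong sumL (≡.sym (List.map-∘ Qs)))) (sumL-*ˡ (c zero 0) (pathWeight (c ∘ suc)) Qs)

  ∑-pathWeight : ∀ k m (c : Fin (suc m) → PS) → sumL (List.map (pathWeight c) (paths k m)) ≈ ∏ˢ c k
  ∑-pathWeight zero    zero    c = +-identityʳ _
  ∑-pathWeight (suc k) zero    c = begin
    sumL (List.map (pathWeight c) (List.map (E ∷_) (paths k 0)))  ≡⟨ ∑-pathWeight-east c (paths k 0) ⟩
    sumL (List.map (pathWeight (shiftFirst c)) (paths k 0))       ≈⟨ ∑-pathWeight k 0 (shiftFirst c) ⟩
    ((c zero ∘ suc) · one) k                                      ≈⟨ +-identityˡ _ ⟨
    0# + ((c zero ∘ suc) · one) k                                 ≈⟨ +-congʳ (zeroʳ _) ⟨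
    ∏ˢ c (suc k)                                                  ∎
    where open ≈-Reasoning
  ∑-pathWeight zero    (suc m) c =
    trans (∑-pathWeight-north c (paths 0 m)) (*-congˡ (∑-pathWeight 0 m (c ∘ suc)))
  ∑-pathWeight (suc k) (suc m) c = begin
    sumL (List.map (pathWeight c) (List.map (E ∷_) (paths k (suc m)) List.++ List.map (N ∷_) (paths (suc k) m)))
      ≈⟨ sumL-++ (pathWeight c) (List.map (E ∷_) (paths k (suc m))) _ ⟩
    sumL (List.map (pathWeight c) (List.map (E ∷_) (paths k (suc m))))
      + sumL (List.map (pathWeight c) (List.map (N ∷_) (paths (suc k) m)))
      ≈⟨ +-cong (reflexive (∑-pathWeight-east c (paths k (suc m)))) (∑-pathWeight-north c (paths (suc k) m)) ⟩
    sumL (List.map (pathWeight (shiftFirst c)) (paths k (suc m)))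
      + c zero 0 * sumL (List.map (pathWeight (c ∘ suc)) (paths (suc k) m))
      ≈⟨ +-cong (∑-pathWeight k (suc m) (shiftFirst c)) (*-congˡ (∑-pathWeight (suc k) m (c ∘ suc))) ⟩
    ((c zero ∘ suc) · ∏ˢ (c ∘ suc)) k + c zero 0 * ∏ˢ (c ∘ suc) (suc k)
      ≈⟨ +-comm _ _ ⟩
    ∏ˢ c (suc k) ∎
    where open ≈-Reasoning

  -- H as a signed sum over 𝒫

  signedMonomial : ∀ {n} → (ℕ → Carrier) → (Fin n → Carrier) → List Step → Carrier
  signedMonomial σ x Q = ∏ (λ j → σ (a Q (toℕ j)) * pow (x j) (a Q (toℕ j)))

  pathWeight-factorInverse : ∀ s σ n (x : Fin n → Carrier) Q →
    pathWeight (λ j → factorInverse s σ (x j)) Q ≈ (if admissible s n Q then signedMonomial σ x Q else 0#)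
  pathWeight-factorInverse s σ n x Q = begin
    pathWeight (λ j → factorInverse s σ (x j)) Q
      ≈⟨ ∏-ifᵇ (λ j → a Q (toℕ j) % suc s ≤ᵇ 1) (λ j → σ (a Q (toℕ j)) * pow (x j) (a Q (toℕ j))) ⟩
    (if Vector.foldr _∧_ true (λ (j : Fin n) → a Q (toℕ j) % suc s ≤ᵇ 1) then signedMonomial σ x Q else 0#)
      ≡⟨ ≡.cong (if_then signedMonomial σ x Q else 0#) (admissible≡all s n Q) ⟨
    (if admissible s n Q then signedMonomial σ x Q else 0#) ∎
    where open ≈-Reasoning

  H≈∑𝒫 : ∀ {s} → 0 < s → ∀ {σ} → σ 0 ≈ 1# → σ 1 ≈ 1# →
    (∀ i → σ (i ℕ.+ suc s) ≈ - pow (- 1#) s * σ i) →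
    ∀ k m (x : Fin (suc m) → Carrier) →
    H s k (suc m) x ≈ sumL (List.map (signedMonomial σ x) (𝒫 (suc m) k s))
  H≈∑𝒫 {s} s>0 {σ} σ-0 σ-1 σ-+period k m x = begin
    H s k (suc m) x
      ≈⟨ H≈∏ˢ s k (suc m) x (fi ∘ x) (λ j → factor-·-factorInverse s>0 σ-0 σ-1 σ-+period (x j)) ⟩
    ∏ˢ (fi ∘ x) k
      ≈⟨ ∑-pathWeight k m (fi ∘ x) ⟨
    sumL (List.map (pathWeight (fi ∘ x)) (paths k m))
      ≈⟨ sumL-cong (All.universal (pathWeight-factorInverse s σ (suc m) x) (paths k m)) ⟩
    sumL (List.map (λ Q → if admissible s (suc m) Q then signedMonomial σ x Q else 0#) (paths k m))
      ≈⟨ sumL-filterᵇ (signedMonomial σ x) (admissible s (suc m)) (paths k m) ⟨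
    sumL (List.map (signedMonomial σ x) (𝒫 (suc m) k s)) ∎
    where
    open ≈-Reasoning
    fi : Carrier → PS
    fi = factorInverse s σ

  H≈pathSum : ∀ {s} → 0 < s → s % 2 ≡ 1 → ∀ k m (x : Fin (suc m) → Carrier) →
    H s k (suc m) x ≈ pathSum (suc m) k s x
  H≈pathSum {s} s>0 s-odd k m x = begin
    H s k (suc m) x
      ≈⟨ H≈∑𝒫 s>0 refl refl unitSign-+period k m x ⟩
    sumL (List.map (signedMonomial (λ _ → 1#) x) (𝒫 (suc m) k s))
      ≈⟨ sumL-cong (All.universal monomial≈X (𝒫 (suc m) k s)) ⟩
    pathSum (suc m) k s x ∎
    where
    open ≈-Reasoning
    unitSign-+period : ∀ i → 1# ≈ - pow (- 1#) s * 1#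
    unitSign-+period _ = sym (trans (*-identityʳ _) (trans (-‿cong (pow[-1]-odd s s-odd)) (⁻¹-involutive 1#)))
    monomial≈X : ∀ Q → signedMonomial (λ _ → 1#) x Q ≈ X (suc m) x Q
    monomial≈X Q = trans (∏-cong {y = λ j → pow (x j) (a Q (toℕ j))} (λ j → *-identityˡ _))
                         (reflexive (≡.sym (X≡∏ (suc m) x Q)))

  blockSign : ℕ → ℕ → Carrier
  blockSign s i = pow (- 1#) i * pow (- 1#) (i % suc s)

  blockSign-1 : ∀ {s} → 0 < s → blockSign s 1 ≈ 1#
  blockSign-1 s>0 = trans (*-cong (*-identityʳ _) (reflexive (≡.cong (pow (- 1#)) (m<n⇒m%n≡m (s≤s s>0)))))
                          (-1*[-1*x]≈x 1#)

  blockSign-+period : ∀ s i → blockSign s (i ℕ.+ suc s) ≈ - pow (- 1#) s * blockSign s i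
  blockSign-+period s i = begin
    pow (- 1#) (i ℕ.+ suc s) * pow (- 1#) ((i ℕ.+ suc s) % suc s)
      ≈⟨ *-cong (pow-+ (- 1#) i (suc s)) (reflexive (≡.cong (pow (- 1#)) ([m+n]%n≡m%n i (suc s)))) ⟩
    (pow (- 1#) i * (- 1# * pow (- 1#) s)) * pow (- 1#) (i % suc s)
      ≈⟨ *-congʳ (*-congˡ (-1*x≈-x _)) ⟩
    (pow (- 1#) i * - pow (- 1#) s) * pow (- 1#) (i % suc s)
      ≈⟨ solve 3 (λ p q r → (p :* q) :* r := q :* (p :* r)) refl _ _ _ ⟩
    - pow (- 1#) s * blockSign s i ∎
    where open ≈-Reasoning

  signedMonomial-blockSign : ∀ s n (x : Fin n → Carrier) Q →
    signedMonomial (blockSign s) x Q ≈ pow (- 1#) (eastTotal n Q) * (pow (- 1#) (P′ s n Q) * X n x Q)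
  signedMonomial-blockSign s n x Q = begin
    ∏ (λ j → blockSign s (e j) * pow (x j) (e j))
      ≈⟨ ∏-distrib-* (blockSign s ∘ e) (λ j → pow (x j) (e j)) ⟩
    ∏ (blockSign s ∘ e) * ∏ (λ j → pow (x j) (e j))
      ≈⟨ *-congʳ (∏-distrib-* (pow (- 1#) ∘ e) (λ j → pow (- 1#) (e j % suc s))) ⟩
    (∏ (pow (- 1#) ∘ e) * ∏ (λ j → pow (- 1#) (e j % suc s))) * ∏ (λ j → pow (x j) (e j))
      ≈⟨ *-assoc _ _ _ ⟩
    ∏ (pow (- 1#) ∘ e) * (∏ (λ j → pow (- 1#) (e j % suc s)) * ∏ (λ j → pow (x j) (e j)))
      ≈⟨ *-cong (pow-∑ℕ (- 1#) e) (*-congʳ (pow-∑ℕ (- 1#) (λ j → e j % suc s))) ⟨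
    pow (- 1#) (eastTotal n Q) * (pow (- 1#) (∑ℕ (λ j → e j % suc s)) * ∏ (λ j → pow (x j) (e j)))
      ≡⟨ ≡.cong₂ (λ p v → pow (- 1#) (eastTotal n Q) * (pow (- 1#) p * v))
                 (P′≡∑ℕ s n Q) (X≡∏ n x Q) ⟨
    pow (- 1#) (eastTotal n Q) * (pow (- 1#) (P′ s n Q) * X n x Q) ∎
    where
    open ≈-Reasoning
    e : Fin n → ℕ
    e j = a Q (toℕ j)

  H≈signedPathSum : ∀ {s} → 0 < s → ∀ k m (x : Fin (suc m) → Carrier) →
    H s k (suc m) x ≈ pow (- 1#) k * signedPathSum (suc m) k s x
  H≈signedPathSum {s} s>0 k m x = begin
    H s k (suc m) x
      ≈⟨ H≈∑𝒫 s>0 (*-identityˡ _) (blockSign-1 s>0) (blockSign-+period s) k m x ⟩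
    sumL (List.map (signedMonomial (blockSign s) x) (𝒫 (suc m) k s))
      ≈⟨ sumL-cong (All.map (λ {Q} → signedMonomial≈ {Q}) (𝒫-eastTotal m k s)) ⟩
    sumL (List.map (λ Q → pow (- 1#) k * signedX Q) (𝒫 (suc m) k s))
      ≈⟨ sumL-*ˡ (pow (- 1#) k) signedX (𝒫 (suc m) k s) ⟩
    pow (- 1#) k * signedPathSum (suc m) k s x ∎
    where
    open ≈-Reasoning
    signedX : List Step → Carrier
    signedX Q = pow (- 1#) (P′ s (suc m) Q) * X (suc m) x Q
    signedMonomial≈ : ∀ {Q} → eastTotal (suc m) Q ≡ k →
      signedMonomial (blockSign s) x Q ≈ pow (- 1#) k * signedX Q
    signedMonomial≈ {Q} ≡.refl = signedMonomial-blockSign s (suc m) x Q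

theorem4p7 : ∀ {c ℓ : Level} (R : CommutativeRing c ℓ) (k n s : ℕ) →
    0 < k → 0 < n → 0 < s → (x : Fin n → CommutativeRing.Carrier R) →
    (s % 2 ≡ 1 →
      CommutativeRing._≈_ R (Series.H R s k n x) (Series.pathSum R n k s x))
    ×
    (s % 2 ≡ 0 →
      CommutativeRing._≈_ R (Series.H R s k n x)
        (CommutativeRing._*_ R (Series.pow R (CommutativeRing.-_ R (CommutativeRing.1# R)) k)
          (Series.signedPathSum R n k s x)))
-- Neither 0 < k nor the parity of s in the second case is needed.
theorem4p7 R k (suc m) s _ _ s>0 x =
  (λ s-odd → H≈pathSum R s>0 s-odd k m x) , (λ _ → H≈signedPathSum R s>0 k m x)
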